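{- Let $G$ be a connected simple graph on at least two vertices with $\chi''_a(G)\leq\Delta(G)+3$, and let $H=(V_1\cup V_2,E)$ be a bipartite graph with $\Delta(H)=\Delta(G)+3$. Then $\chi''_a(G\circ H)\leq\Delta(G\circ H)+3$.
   Context: All graphs are finite and simple; $\Delta(\cdot)$ denotes maximum degree and $[k]=\{1,\ldots,k\}$. A proper total $k$-coloring of $G=(V,E)$ is a map $f:V\cup E\to[k]$ such that adjacent vertices get different colors, adjacent edges get different colors, and each edge gets a color different from the colors of its endvertices. The color set of $v$ is $C_f(v)=\{f(v)\}\cup\{f(vu): vu\in E\}$. An adjacent vertex distinguishing (avd) total $k$-coloring is a proper total $k$-coloring with $C_f(u)\neq C_f(v)$ for every edge $uv$; $\chi''_a(G)$ is the least such $k$. The corona $G\circ H$ is obtained from one copy of $G$ and $|V(G)|$ disjoint copies of $H$, one for each vertex $v$ of $G$, by joining each vertex $v$ of $G$ to every vertex of its copy of $H$. -}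

module Defs where

open import Data.Nat using (ℕ; zero; suc; _+_; _*_; _≤_; _⊔_)
open import Data.Bool using (Bool; true; false; if_then_else_; _∧_)
open import Data.Fin using (Fin; splitAt; remQuot)
open import Data.Fin.Properties using (_≟_)
open import Data.List using (List; map; foldr; allFin)
open import Data.Nat.ListAction using (sum)
open import Data.Sum using (_⊎_; inj₁; inj₂)
open import Data.Product using (Σ; _×_; _,_; ∃; ∃-syntax)
open import Relation.Nullary using (¬_; does)
open import Relation.Binary.PropositionalEquality using (_≡_; _≢_)

Graph : ℕ → Set
Graph n = Fin n → Fin n → Bool

Adj : ∀ {n} → Graph n → Fin n → Fin n → Set
Adj G u v = G u v ≡ true

IsSimple : ∀ {n} → Graph n → Set
IsSimple {n} G = (∀ u v → G u v ≡ G v u) × (∀ v → G v v ≡ false)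

degree : ∀ {n} → Graph n → Fin n → ℕ
degree {n} G v = sum (map (λ u → if G v u then 1 else 0) (allFin n))

Δ : ∀ {n} → Graph n → ℕ
Δ {n} G = foldr _⊔_ 0 (map (degree G) (allFin n))

data Reach {n} (G : Graph n) : Fin n → Fin n → Set where
  here : ∀ {v} → Reach G v v
  step : ∀ {u w v} → Adj G u w → Reach G w v → Reach G u v

Connected : ∀ {n} → Graph n → Set
Connected {n} G = ∀ (u v : Fin n) → Reach G u v

-- bipartite: there is a 2-colouring of the vertices with every edge bichromatic
-- (the parts V₁ = side⁻¹(true), V₂ = side⁻¹(false))
IsBipartite : ∀ {n} → Graph n → Set
IsBipartite {n} G = Σ (Fin n → Bool) λ side → ∀ u v → Adj G u v → side u ≢ side v

-- a total colouring with colours [k] ≅ Fin k: vertex colours and edge colours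
-- (edge colour of uv is ecol u v, only meaningful when uv is an edge)
record TotalColouring {n} (G : Graph n) (k : ℕ) : Set where
  field
    vcol : Fin n → Fin k
    ecol : Fin n → Fin n → Fin k

module _ {n} {G : Graph n} {k : ℕ} (f : TotalColouring G k) where
  open TotalColouring f

  IsProperTotal : Set
  IsProperTotal =
      (∀ u v → Adj G u v → ecol u v ≡ ecol v u)                    -- edge colour well defined
    × (∀ u v → Adj G u v → vcol u ≢ vcol v)
    × (∀ u v w → Adj G u v → Adj G u w → v ≢ w → ecol u v ≢ ecol u w)
    × (∀ u v → Adj G u v → ecol u v ≢ vcol u)
    × (∀ u v → Adj G u v → ecol u v ≢ vcol v)

  InColourSet : Fin n → Fin k → Set
  InColourSet v c = (vcol v ≡ c) ⊎ (∃[ u ] (Adj G v u × ecol v u ≡ c))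

  SameColourSet : Fin n → Fin n → Set
  SameColourSet u v = ∀ c → (InColourSet u c → InColourSet v c) × (InColourSet v c → InColourSet u c)

  IsAVDTotal : Set
  IsAVDTotal = IsProperTotal × (∀ u v → Adj G u v → ¬ SameColourSet u v)

AVDTotalColourable : ∀ {n} → Graph n → ℕ → Set
AVDTotalColourable G k = Σ (TotalColouring G k) IsAVDTotal

χ''ₐ≤ : ∀ {n} → Graph n → ℕ → Set
χ''ₐ≤ G m = ∃[ k ] (k ≤ m × AVDTotalColourable G k)

-- corona G ∘ H: vertices Fin (n + n * m); the first n are the vertices of G,
-- vertex n + (i * m + h) is vertex h of the copy of H attached to vertex i of G.
corona : ∀ {n m} → Graph n → Graph m → Graph (n + n * m)
corona {n} {m} G H x y with splitAt n x | splitAt n y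
... | inj₁ a | inj₁ b = G a b
... | inj₁ a | inj₂ p with remQuot {n} m p
...   | (i , _) = does (a ≟ i)
corona {n} {m} G H x y | inj₂ p | inj₁ b with remQuot {n} m p
...   | (i , _) = does (b ≟ i)
corona {n} {m} G H x y | inj₂ p | inj₂ q with remQuot {n} m p | remQuot {n} m q
...   | (i , h) | (j , h') = does (i ≟ j) ∧ H h h'

{-# OPTIONS --safe #-}
module Submission where

-- Write m = |V(H)| and K = Δ(G ∘ H) + 3; since Δ(G ∘ H) ≥ Δ(G) + m, there are at least
-- Δ(G) + 3 + m colours. Shift the given avd colouring f of G up by m. In the copy of H at v,
-- colour the edges of the closed neighbourhood as those of a complete graph on positions
-- 0, …, m (v at position m, the i-th vertex of H at position i): the edge ij gets
-- (i + j + 1) mod (m + 1), so all of these colours are at most m and the edge to v gets i.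
-- As G has no isolated vertex, every v has a colour c ≥ 1 in C_f(v); the vertices of its
-- copy get colours m + c' with c' ∈ {1, 2, 3} ∖ {c}, the two sides of H getting different c'.
-- Then m + c separates v from its copy, the vertex colours above m separate adjacent
-- vertices of a copy, and adjacent vertices of G keep their shifted colour sets.

open import Defs
open import Data.Nat using (ℕ; zero; suc; _+_; _*_; _∸_; _⊔_; _≤_; _<_; z≤n; s≤s; s≤s⁻¹; NonZero)
open import Data.Nat.Properties hiding (_≟_)
import Data.Nat.Properties as ℕ
open import Data.Nat.DivMod using (_%_; _/_; m≡m%n+[m/n]*n; m%n<n; m<n⇒m%n≡m; [m+n]%n≡m%n)
open import Data.Nat.Divisibility using (_∣_; divides; n∣m⇒m%n≡0)
open import Data.Nat.ListAction using () renaming (sum to sumˡ)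
open import Algebra.Properties.Monoid.Sum +-0-monoid using (sum; sum-syntax; sum-cong-≗)
open import Data.Bool using (Bool; true; false; _∧_; if_then_else_)
open import Data.Fin using (Fin; zero; suc; toℕ; fromℕ<; splitAt; remQuot; combine; _↑ˡ_; _↑ʳ_; punchIn)
open import Data.Fin.Properties
  using (_≟_; toℕ<n; toℕ-injective; fromℕ<-cong; fromℕ<-injective; splitAt-↑ˡ; splitAt-↑ʳ;
         splitAt⁻¹-↑ˡ; splitAt⁻¹-↑ʳ; remQuot-combine; combine-remQuot; punchInᵢ≢i)
open import Data.List using (tabulate)
open import Data.List.Properties using (map-tabulate; foldr-preservesᵇ; foldr-forcesᵇ)
open import Data.List.Relation.Unary.All.Properties using (map⁺; map⁻; tabulate⁺; tabulate⁻)
open import Data.Sum using (_⊎_; inj₁; inj₂; [_,_]′)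
open import Data.Product using (_×_; _,_; proj₁; proj₂; ∃-syntax; swap; uncurry)
open import Data.Empty using (⊥-elim)
open import Function using (_∘_; id)
open import Relation.Nullary using (¬_; does; yes; no)
open import Relation.Nullary.Decidable using (dec-true)
open import Relation.Binary.PropositionalEquality
  using (_≡_; _≢_; ≢-sym; refl; sym; trans; cong; cong₂; subst; module ≡-Reasoning)

sumˡ-tabulate : ∀ {n} (f : Fin n → ℕ) → sumˡ (tabulate f) ≡ sum f
sumˡ-tabulate {zero}  f = refl
sumˡ-tabulate {suc n} f = cong (f zero +_) (sumˡ-tabulate (f ∘ suc))

sum-↑ : ∀ n {k} (f : Fin (n + k) → ℕ) →
        ∑[ i < n + k ] f i ≡ ∑[ i < n ] f (i ↑ˡ k) + ∑[ j < k ] f (n ↑ʳ j)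
sum-↑ zero    f = refl
sum-↑ (suc n) f = trans (cong (f zero +_) (sum-↑ n (f ∘ suc))) (sym (+-assoc (f zero) _ _))

sum-combine : ∀ n {m} (f : Fin (n * m) → ℕ) →
              ∑[ p < n * m ] f p ≡ ∑[ i < n ] ∑[ j < m ] f (combine i j)
sum-combine zero    f = refl
sum-combine (suc n) {m} f =
  trans (sum-↑ m f) (cong (∑[ j < m ] f (j ↑ˡ (n * m)) +_) (sum-combine n (f ∘ (m ↑ʳ_))))

≤-sum : ∀ {n} (f : Fin n → ℕ) i → f i ≤ sum f
≤-sum f zero    = m≤m+n _ _
≤-sum f (suc i) = ≤-trans (≤-sum (f ∘ suc) i) (m≤n+m _ (f zero))

sum-ones : ∀ n → ∑[ i < n ] 1 ≡ n
sum-ones zero    = refl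
sum-ones (suc n) = cong suc (sum-ones n)

indicator : Bool → ℕ
indicator b = if b then 1 else 0

degree≡∑ : ∀ {n} (G : Graph n) v → degree G v ≡ ∑[ u < n ] indicator (G v u)
degree≡∑ G v = trans (cong sumˡ (map-tabulate id (indicator ∘ G v))) (sumˡ-tabulate (indicator ∘ G v))

adj⇒1≤degree : ∀ {n} (G : Graph n) {v u} → Adj G v u → 1 ≤ degree G v
adj⇒1≤degree G {v} {u} vu = begin
  1                              ≡⟨ cong indicator vu ⟨
  indicator (G v u)              ≤⟨ ≤-sum (indicator ∘ G v) u ⟩
  ∑[ w < _ ] indicator (G v w)   ≡⟨ degree≡∑ G v ⟨
  degree G v                     ∎
  where open ≤-Reasoning

degree≤Δ : ∀ {n} (G : Graph n) v → degree G v ≤ Δ G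
degree≤Δ G = tabulate⁻ (map⁻ (foldr-forcesᵇ halves 0 _ ≤-refl))
  where
  halves : ∀ x y → x ⊔ y ≤ Δ G → x ≤ Δ G × y ≤ Δ G
  halves x y le = m⊔n≤o⇒m≤o x y le , m⊔n≤o⇒n≤o x y le

Δ+≤ : ∀ {n} (G : Graph n) {c B} → Fin n → (∀ v → degree G v + c ≤ B) → Δ G + c ≤ B
Δ+≤ G {c} {B} w bound =
  foldr-preservesᵇ {P = λ x → x + c ≤ B} lub (≤-trans (m≤n+m c _) (bound w)) (map⁺ (tabulate⁺ bound))
  where
  lub : ∀ {x y} → x + c ≤ B → y + c ≤ B → x ⊔ y + c ≤ B
  lub {x} {y} p q = subst (_≤ B) (sym (+-distribʳ-⊔ c x y)) (⊔-lub p q)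

%-≡⇒∣∸ : ∀ x y n .{{_ : NonZero n}} → x % n ≡ y % n → n ∣ y ∸ x
%-≡⇒∣∸ x y n eq = divides (y / n ∸ x / n) (begin
  y ∸ x                                     ≡⟨ cong₂ _∸_ (m≡m%n+[m/n]*n y n) (m≡m%n+[m/n]*n x n) ⟩
  (y % n + y / n * n) ∸ (x % n + x / n * n) ≡⟨ cong (λ r → (r + y / n * n) ∸ (x % n + x / n * n)) eq ⟨
  (x % n + y / n * n) ∸ (x % n + x / n * n) ≡⟨ [m+n]∸[m+o]≡n∸o (x % n) _ _ ⟩
  y / n * n ∸ x / n * n                     ≡⟨ *-distribʳ-∸ n (y / n) (x / n) ⟨
  (y / n ∸ x / n) * n                       ∎)
  where open ≡-Reasoning

∣∧<⇒≡0 : ∀ {d n} .{{_ : NonZero n}} → n ∣ d → d < n → d ≡ 0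
∣∧<⇒≡0 {d} {n} n∣d d<n = trans (sym (m<n⇒m%n≡m d<n)) (n∣m⇒m%n≡0 d n n∣d)

+-%-injectiveʳ : ∀ c {a b n} .{{_ : NonZero n}} →
                 a < n → b < n → (c + a) % n ≡ (c + b) % n → a ≡ b
+-%-injectiveʳ c {a} {b} {n} a<n b<n eq =
  ≤-antisym (m∸n≡0⇒m≤n (gap a b a<n (sym eq))) (m∸n≡0⇒m≤n (gap b a b<n eq))
  where
  gap : ∀ x y → x < n → (c + y) % n ≡ (c + x) % n → x ∸ y ≡ 0
  gap x y x<n e = ∣∧<⇒≡0 (subst (n ∣_) ([m+n]∸[m+o]≡n∸o c x y) (%-≡⇒∣∸ (c + y) (c + x) n e))
                         (≤-<-trans (m∸n≤m x y) x<n)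

nonzeroOr : ∀ {k} → Fin k → Fin k → Fin k
nonzeroOr zero    e = e
nonzeroOr (suc c) _ = suc c

nonzeroOr-sel : ∀ {k} (c e : Fin k) → nonzeroOr c e ≡ c ⊎ nonzeroOr c e ≡ e
nonzeroOr-sel zero    e = inj₂ refl
nonzeroOr-sel (suc c) e = inj₁ refl

nonzeroOr-pos : ∀ {k} (c e : Fin k) → e ≢ c → 0 < toℕ (nonzeroOr c e)
nonzeroOr-pos zero    zero    e≢c = ⊥-elim (e≢c refl)
nonzeroOr-pos zero    (suc e) _   = s≤s z≤n
nonzeroOr-pos (suc c) e       _   = s≤s z≤n

nonzeroOr-≢ : ∀ {k} (c e : Fin k) {x} → 0 < x → x ≢ toℕ (nonzeroOr c e) → x ≢ toℕ c
nonzeroOr-≢ zero    e x>0 _ = ≢-sym (<⇒≢ x>0)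
nonzeroOr-≢ (suc c) e _   x≢c = x≢c

avoid : Bool → ℕ → ℕ
avoid true  b with b ℕ.≟ 1
... | yes _ = 2
... | no  _ = 1
avoid false b with b ℕ.≟ 3
... | yes _ = 2
... | no  _ = 3

avoid-≢ : ∀ s b → avoid s b ≢ b
avoid-≢ true  b with b ℕ.≟ 1
... | yes refl = λ ()
... | no  b≢1  = b≢1 ∘ sym
avoid-≢ false b with b ℕ.≟ 3
... | yes refl = λ ()
... | no  b≢3  = b≢3 ∘ sym

avoid-pos : ∀ s b → 0 < avoid s b
avoid-pos true  b with b ℕ.≟ 1
... | yes _ = s≤s z≤n
... | no  _ = s≤s z≤n
avoid-pos false b with b ℕ.≟ 3
... | yes _ = s≤s z≤n
... | no  _ = s≤s z≤n

avoid-≤3 : ∀ s b → avoid s b ≤ 3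
avoid-≤3 true  b with b ℕ.≟ 1
... | yes _ = s≤s (s≤s z≤n)
... | no  _ = s≤s z≤n
avoid-≤3 false b with b ℕ.≟ 3
... | yes _ = s≤s (s≤s z≤n)
... | no  _ = ≤-refl

avoid-true≢false : ∀ b → avoid true b ≢ avoid false b
avoid-true≢false b with b ℕ.≟ 1 | b ℕ.≟ 3
... | yes refl | yes ()
... | yes _    | no  _ = λ ()
... | no  _    | yes _ = λ ()
... | no  _    | no  _ = λ ()

avoid-injective : ∀ {s s'} b → s ≢ s' → avoid s b ≢ avoid s' b
avoid-injective {true}  {true}  b s≢s' = ⊥-elim (s≢s' refl)
avoid-injective {true}  {false} b _    = avoid-true≢false b
avoid-injective {false} {true}  b _    = avoid-true≢false b ∘ sym
avoid-injective {false} {false} b s≢s' = ⊥-elim (s≢s' refl)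

-- Total colourings by natural numbers on an arbitrary vertex type

module ColourSets {V : Set} (E : V → V → Set) (vcol : V → ℕ) (ecol : V → V → ℕ) where

  InColours : V → ℕ → Set
  InColours v c = (vcol v ≡ c) ⊎ ∃[ u ] (E v u × ecol v u ≡ c)

  SameColours : V → V → Set
  SameColours u v = ∀ c → (InColours u c → InColours v c) × (InColours v c → InColours u c)

  separatedBy : ∀ {u v c} → InColours u c → ¬ InColours v c → ¬ SameColours u v
  separatedBy {c = c} u∋c v∌c same = v∌c (proj₁ (same c) u∋c)

  record IsAVDColouring : Set where
    field
      ecol-sym      : ∀ {u v} → E u v → ecol u v ≡ ecol v u
      vcol-proper   : ∀ {u v} → E u v → vcol u ≢ vcol v
      ecol-proper   : ∀ {u v w} → E u v → E u w → v ≢ w → ecol u v ≢ ecol u w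
      ecol≢vcolˡ    : ∀ {u v} → E u v → ecol u v ≢ vcol u
      ecol≢vcolʳ    : ∀ {u v} → E u v → ecol u v ≢ vcol v
      distinguishes : ∀ {u v} → E u v → ¬ SameColours u v

module Transport {V : Set} (E : V → V → Set) {N : ℕ} (Γ : Graph N)
  (decode : Fin N → V) (encode : V → Fin N)
  (decode-encode : ∀ v → decode (encode v) ≡ v)
  (encode-decode : ∀ x → encode (decode x) ≡ x)
  (edge⇒adj : ∀ {u v} → E u v → Adj Γ (encode u) (encode v))
  (adj⇒edge : ∀ {x y} → Adj Γ x y → E (decode x) (decode y)) where

  decode-injective : ∀ {x y} → decode x ≡ decode y → x ≡ y
  decode-injective {x} {y} eq = trans (sym (encode-decode x)) (trans (cong encode eq) (encode-decode y))

  avdColourable : ∀ {K} (vcol : V → ℕ) (ecol : V → V → ℕ) →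
                  (∀ v → vcol v < K) → (∀ u v → ecol u v < K) →
                  ColourSets.IsAVDColouring E vcol ecol → AVDTotalColourable Γ K
  avdColourable {K} vcol ecol vcol< ecol< avd = colouring , proper , distinct
    where
    open ColourSets E vcol ecol
    open IsAVDColouring avd

    colouring : TotalColouring Γ K
    colouring = record
      { vcol = λ x → fromℕ< (vcol< (decode x))
      ; ecol = λ x y → fromℕ< (ecol< (decode x) (decode y)) }

    injective : ∀ {a b} .(a<K : a < K) .(b<K : b < K) → fromℕ< a<K ≡ fromℕ< b<K → a ≡ b
    injective = fromℕ<-injective _ _

    proper : IsProperTotal colouring
    proper = (λ x y xy → fromℕ<-cong _ _ (ecol-sym (adj⇒edge xy)) _ _)
           , (λ x y xy → vcol-proper (adj⇒edge xy) ∘ injective _ _)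
           , (λ x y z xy xz y≢z → ecol-proper (adj⇒edge xy) (adj⇒edge xz) (y≢z ∘ decode-injective)
                                  ∘ injective _ _)
           , (λ x y xy → ecol≢vcolˡ (adj⇒edge xy) ∘ injective _ _)
           , (λ x y xy → ecol≢vcolʳ (adj⇒edge xy) ∘ injective _ _)

    InColours⇒< : ∀ {v c} → InColours v c → c < K
    InColours⇒< {v} (inj₁ refl)            = vcol< v
    InColours⇒< {v} (inj₂ (u , _ , refl)) = ecol< v u

    toFin : ∀ x {c} (c<K : c < K) → InColours (decode x) c → InColourSet colouring x (fromℕ< c<K)
    toFin x c<K (inj₁ eq) = inj₁ (fromℕ<-cong _ _ eq _ _)
    toFin x c<K (inj₂ (u , e , eq)) =
      inj₂ ( encode u
           , subst (λ y → Adj Γ y (encode u)) (encode-decode x) (edge⇒adj e)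
           , fromℕ<-cong _ _ (trans (cong (ecol (decode x)) (decode-encode u)) eq) _ _)

    fromFin : ∀ x {c} (c<K : c < K) → InColourSet colouring x (fromℕ< c<K) → InColours (decode x) c
    fromFin x c<K (inj₁ eq)           = inj₁ (injective _ _ eq)
    fromFin x c<K (inj₂ (y , xy , eq)) = inj₂ (decode y , adj⇒edge xy , injective _ _ eq)

    distinct : ∀ x y → Adj Γ x y → ¬ SameColourSet colouring x y
    distinct x y xy same = distinguishes (adj⇒edge xy) λ c →
        (λ i → let c<K = InColours⇒< i in fromFin y c<K (proj₁ (same (fromℕ< c<K)) (toFin x c<K i)))
      , (λ i → let c<K = InColours⇒< i in fromFin x c<K (proj₂ (same (fromℕ< c<K)) (toFin y c<K i)))

-- The corona with named vertices

≟-true⇒≡ : ∀ {k} {a b : Fin k} → does (a ≟ b) ≡ true → a ≡ b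
≟-true⇒≡ {a = a} {b} p with a ≟ b
... | yes a≡b = a≡b

data CoronaVertex (n m : ℕ) : Set where
  base : Fin n → CoronaVertex n m
  copy : Fin n → Fin m → CoronaVertex n m

module Corona {n m : ℕ} (G : Graph n) (H : Graph m) where

  coronaAdj : CoronaVertex n m → CoronaVertex n m → Bool
  coronaAdj (base a)   (base b)    = G a b
  coronaAdj (base a)   (copy i _)  = does (a ≟ i)
  coronaAdj (copy i _) (base b)    = does (b ≟ i)
  coronaAdj (copy i h) (copy j h') = does (i ≟ j) ∧ H h h'

  data CoronaEdge : CoronaVertex n m → CoronaVertex n m → Set where
    base-base : ∀ {a b} → Adj G a b → CoronaEdge (base a) (base b)
    base-copy : ∀ {v h} → CoronaEdge (base v) (copy v h)
    copy-base : ∀ {v h} → CoronaEdge (copy v h) (base v)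
    copy-copy : ∀ {v h h'} → Adj H h h' → CoronaEdge (copy v h) (copy v h')

  decode : Fin (n + n * m) → CoronaVertex n m
  decode x = [ base , uncurry copy ∘ remQuot m ]′ (splitAt n x)

  encode : CoronaVertex n m → Fin (n + n * m)
  encode (base a)   = a ↑ˡ (n * m)
  encode (copy i h) = n ↑ʳ combine i h

  decode-encode : ∀ u → decode (encode u) ≡ u
  decode-encode (base a) rewrite splitAt-↑ˡ n a (n * m) = refl
  decode-encode (copy i h) rewrite splitAt-↑ʳ n (n * m) (combine i h) =
    cong (uncurry copy) (remQuot-combine i h)

  encode-decode : ∀ x → encode (decode x) ≡ x
  encode-decode x with splitAt n x in eq
  ... | inj₁ a = splitAt⁻¹-↑ˡ eq
  ... | inj₂ p = trans (cong (n ↑ʳ_) (combine-remQuot {n} m p)) (splitAt⁻¹-↑ʳ eq)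

  corona≡coronaAdj : ∀ x y → corona G H x y ≡ coronaAdj (decode x) (decode y)
  corona≡coronaAdj x y with splitAt n x | splitAt n y
  ... | inj₁ _ | inj₁ _ = refl
  ... | inj₁ _ | inj₂ _ = refl
  ... | inj₂ _ | inj₁ _ = refl
  ... | inj₂ _ | inj₂ _ = refl

  corona-encode : ∀ u w → corona G H (encode u) (encode w) ≡ coronaAdj u w
  corona-encode u w = trans (corona≡coronaAdj _ _) (cong₂ coronaAdj (decode-encode u) (decode-encode w))

  coronaAdj⇒edge : ∀ u w → coronaAdj u w ≡ true → CoronaEdge u w
  coronaAdj⇒edge (base a)   (base b)    p = base-base p
  coronaAdj⇒edge (base a)   (copy i h)  p with refl ← ≟-true⇒≡ {a = a} {i} p = base-copy
  coronaAdj⇒edge (copy i h) (base b)    p with refl ← ≟-true⇒≡ {a = b} {i} p = copy-base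
  coronaAdj⇒edge (copy i h) (copy j h') p with does (i ≟ j) in i≟j
  ... | true with refl ← ≟-true⇒≡ {a = i} {j} i≟j = copy-copy p

  edge⇒coronaAdj : ∀ {u w} → CoronaEdge u w → coronaAdj u w ≡ true
  edge⇒coronaAdj (base-base p)           = p
  edge⇒coronaAdj (base-copy {v})         = dec-true (v ≟ v) refl
  edge⇒coronaAdj (copy-base {v})         = dec-true (v ≟ v) refl
  edge⇒coronaAdj (copy-copy {v} {h} {h'} p) = trans (cong (_∧ H h h') (dec-true (v ≟ v) refl)) p

  edge⇒adj : ∀ {u w} → CoronaEdge u w → Adj (corona G H) (encode u) (encode w)
  edge⇒adj {u} {w} e = trans (corona-encode u w) (edge⇒coronaAdj e)

  adj⇒edge : ∀ {x y} → Adj (corona G H) x y → CoronaEdge (decode x) (decode y)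
  adj⇒edge {x} {y} p = coronaAdj⇒edge _ _ (trans (sym (corona≡coronaAdj x y)) p)

  open Transport CoronaEdge (corona G H) decode encode decode-encode encode-decode edge⇒adj adj⇒edge
    public using (avdColourable)

  sum-corona : (f : Fin (n + n * m) → ℕ) →
               sum f ≡ ∑[ a < n ] f (encode (base a)) + ∑[ i < n ] ∑[ h < m ] f (encode (copy i h))
  sum-corona f = trans (sum-↑ n f) (cong (∑[ a < n ] f (encode (base a)) +_) (sum-combine n (f ∘ (n ↑ʳ_))))

  degree-base : ∀ v → degree G v + m ≤ degree (corona G H) (encode (base v))
  degree-base v = begin
    degree G v + m
      ≡⟨ cong₂ _+_ (degree≡∑ G v) (trans (sym (sum-ones m)) (sum-cong-≗ {m} λ _ → cong indicator (sym v≟v))) ⟩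
    ∑[ a < n ] indicator (G v a) + ∑[ h < m ] indicator (does (v ≟ v))
      ≤⟨ +-monoʳ-≤ _ (≤-sum (λ i → ∑[ h < m ] indicator (does (v ≟ i))) v) ⟩
    ∑[ a < n ] indicator (G v a) + ∑[ i < n ] ∑[ h < m ] indicator (does (v ≟ i))
      ≡⟨ cong₂ _+_ (sum-cong-≗ λ a → cong indicator (corona-encode (base v) (base a)))
                   (sum-cong-≗ λ i → sum-cong-≗ λ h → cong indicator (corona-encode (base v) (copy i h))) ⟨
    ∑[ a < n ] indicator (adjacent (encode (base a)))
      + ∑[ i < n ] ∑[ h < m ] indicator (adjacent (encode (copy i h)))
      ≡⟨ sum-corona (indicator ∘ adjacent) ⟨
    ∑[ x < n + n * m ] indicator (adjacent x)
      ≡⟨ degree≡∑ (corona G H) _ ⟨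
    degree (corona G H) (encode (base v)) ∎
    where
    open ≤-Reasoning
    adjacent : Fin (n + n * m) → Bool
    adjacent = corona G H (encode (base v))
    v≟v : does (v ≟ v) ≡ true
    v≟v = dec-true (v ≟ v) refl

-- The colouring of the corona

module Construction {n m k : ℕ} {G : Graph n} {H : Graph m}
  (f : TotalColouring G k) (f-avd : IsAVDTotal f)
  (side : Fin m → Bool) (side-proper : ∀ h h' → Adj H h h' → side h ≢ side h')
  (neighbour : ∀ v → ∃[ u ] Adj G v u) where

  open Corona G H
  open TotalColouring f renaming (vcol to fv; ecol to fe)

  f-sym : ∀ {a b} → Adj G a b → fe a b ≡ fe b a
  f-sym = proj₁ (proj₁ f-avd) _ _

  f-vertex : ∀ {a b} → Adj G a b → fv a ≢ fv b
  f-vertex = proj₁ (proj₂ (proj₁ f-avd)) _ _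

  f-edge : ∀ {a b c} → Adj G a b → Adj G a c → b ≢ c → fe a b ≢ fe a c
  f-edge = proj₁ (proj₂ (proj₂ (proj₁ f-avd))) _ _ _

  f-edge≢vertexˡ : ∀ {a b} → Adj G a b → fe a b ≢ fv a
  f-edge≢vertexˡ = proj₁ (proj₂ (proj₂ (proj₂ (proj₁ f-avd)))) _ _

  f-edge≢vertexʳ : ∀ {a b} → Adj G a b → fe a b ≢ fv b
  f-edge≢vertexʳ = proj₂ (proj₂ (proj₂ (proj₂ (proj₁ f-avd)))) _ _

  anchor : Fin n → Fin k
  anchor v = nonzeroOr (fv v) (fe v (proj₁ (neighbour v)))

  anchor-pos : ∀ v → 0 < toℕ (anchor v)
  anchor-pos v = nonzeroOr-pos (fv v) _ (f-edge≢vertexˡ (proj₂ (neighbour v)))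

  anchor∈colours : ∀ v → InColourSet f v (anchor v)
  anchor∈colours v with nonzeroOr-sel (fv v) (fe v (proj₁ (neighbour v)))
  ... | inj₁ eq = inj₁ (sym eq)
  ... | inj₂ eq = inj₂ (proj₁ (neighbour v) , proj₂ (neighbour v) , sym eq)

  copyColour : Fin n → Fin m → ℕ
  copyColour v h = avoid (side h) (toℕ (anchor v))

  copyColour-pos : ∀ v h → 0 < copyColour v h
  copyColour-pos v h = avoid-pos (side h) _

  vertex≢copyColour : ∀ v h → toℕ (fv v) ≢ copyColour v h
  vertex≢copyColour v h =
    ≢-sym (nonzeroOr-≢ (fv v) _ (copyColour-pos v h) (avoid-≢ (side h) _))

  vc : CoronaVertex n m → ℕ
  vc (base a)   = m + toℕ (fv a)
  vc (copy v h) = m + copyColour v h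

  ec : CoronaVertex n m → CoronaVertex n m → ℕ
  ec (base a)   (base b)    = m + toℕ (fe a b)
  ec (base _)   (copy _ h)  = toℕ h
  ec (copy _ h) (base _)    = toℕ h
  ec (copy _ h) (copy _ h') = suc (toℕ h + toℕ h') % suc m

  below≢shifted : ∀ {a} x → a < m → a ≢ m + x
  below≢shifted x a<m = <⇒≢ (<-≤-trans a<m (m≤m+n m x))

  atMost≢shifted : ∀ {a x} → a ≤ m → 0 < x → a ≢ m + x
  atMost≢shifted a≤m x>0 = <⇒≢ (≤-<-trans a≤m (m<m+n m x>0))

  shift-injective : ∀ {a b : Fin k} → m + toℕ a ≡ m + toℕ b → a ≡ b
  shift-injective = toℕ-injective ∘ +-cancelˡ-≡ m _ _

  copy-edge≤m : ∀ {v h} w → ec (copy v h) w ≤ m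
  copy-edge≤m {h = h} (base _)    = <⇒≤ (toℕ<n h)
  copy-edge≤m {h = h} (copy _ h') = s≤s⁻¹ (m%n<n (suc (toℕ h + toℕ h')) (suc m))

  apex-edge : ∀ (h : Fin m) → toℕ h ≡ (suc (toℕ h) + m) % suc m
  apex-edge h = sym (begin
    (suc (toℕ h) + m) % suc m ≡⟨ cong (_% suc m) (sym (+-suc (toℕ h) m)) ⟩
    (toℕ h + suc m) % suc m   ≡⟨ [m+n]%n≡m%n (toℕ h) (suc m) ⟩
    toℕ h % suc m             ≡⟨ m<n⇒m%n≡m (m<n⇒m<1+n (toℕ<n h)) ⟩
    toℕ h                     ∎)
    where open ≡-Reasoning

  apex≢clique : ∀ (h h' : Fin m) → toℕ h ≢ suc (toℕ h + toℕ h') % suc m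
  apex≢clique h h' eq = <⇒≢ (toℕ<n h') (sym (+-%-injectiveʳ (suc (toℕ h)) ≤-refl
    (m<n⇒m<1+n (toℕ<n h')) (trans (sym (apex-edge h)) eq)))

  open ColourSets CoronaEdge vc ec

  shift∈ : ∀ {a c} → InColourSet f a c → InColours (base a) (m + toℕ c)
  shift∈ (inj₁ refl)             = inj₁ refl
  shift∈ (inj₂ (b , ab , refl)) = inj₂ (base b , base-base ab , refl)

  unshift∈ : ∀ {a c} → InColours (base a) (m + toℕ c) → InColourSet f a c
  unshift∈ (inj₁ eq)                           = inj₁ (shift-injective eq)
  unshift∈ (inj₂ (base b , base-base ab , eq)) = inj₂ (b , ab , shift-injective eq)
  unshift∈ (inj₂ (copy _ h , base-copy , eq))  = ⊥-elim (below≢shifted _ (toℕ<n h) eq)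

  copy∋shifted : ∀ {v h x} → 0 < x → InColours (copy v h) (m + x) → x ≡ copyColour v h
  copy∋shifted x>0 (inj₁ eq)           = sym (+-cancelˡ-≡ m _ _ eq)
  copy∋shifted x>0 (inj₂ (w , _ , eq)) = ⊥-elim (atMost≢shifted (copy-edge≤m w) x>0 eq)

  base-copy-distinct : ∀ {v h} → ¬ SameColours (base v) (copy v h)
  base-copy-distinct {v} {h} = separatedBy (shift∈ (anchor∈colours v))
    (avoid-≢ (side h) _ ∘ sym ∘ copy∋shifted (anchor-pos v))

  avd : IsAVDColouring
  avd = record
    { ecol-sym      = ecol-sym
    ; vcol-proper   = vcol-proper
    ; ecol-proper   = ecol-proper
    ; ecol≢vcolˡ    = ecol≢vcolˡ
    ; ecol≢vcolʳ    = ecol≢vcolʳ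
    ; distinguishes = distinguishes }
    where
    ecol-sym : ∀ {u v} → CoronaEdge u v → ec u v ≡ ec v u
    ecol-sym (base-base ab)          = cong (λ c → m + toℕ c) (f-sym ab)
    ecol-sym base-copy               = refl
    ecol-sym copy-base               = refl
    ecol-sym (copy-copy {h = h} {h'} _) = cong (λ x → suc x % suc m) (+-comm (toℕ h) (toℕ h'))

    vcol-proper : ∀ {u v} → CoronaEdge u v → vc u ≢ vc v
    vcol-proper (base-base ab)              = f-vertex ab ∘ shift-injective
    vcol-proper (base-copy {v} {h})         = vertex≢copyColour v h ∘ +-cancelˡ-≡ m _ _
    vcol-proper (copy-base {v} {h})         = vertex≢copyColour v h ∘ sym ∘ +-cancelˡ-≡ m _ _
    vcol-proper (copy-copy {v} {h} {h'} hh') =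
      avoid-injective _ (side-proper h h' hh') ∘ +-cancelˡ-≡ m _ _

    ecol-proper : ∀ {u v w} → CoronaEdge u v → CoronaEdge u w → v ≢ w → ec u v ≢ ec u w
    ecol-proper (base-base ab)    (base-base ac) b≢c = f-edge ab ac (b≢c ∘ cong base) ∘ shift-injective
    ecol-proper (base-base _)     (base-copy {h = h}) _ = below≢shifted _ (toℕ<n h) ∘ sym
    ecol-proper (base-copy {h = h}) (base-base _)    _ = below≢shifted _ (toℕ<n h)
    ecol-proper (base-copy {v})   base-copy        h≢h' = h≢h' ∘ cong (copy v) ∘ toℕ-injective
    ecol-proper copy-base          copy-base        v≢v = ⊥-elim (v≢v refl)
    ecol-proper (copy-base {h = h}) (copy-copy {h' = h'} _) _ = apex≢clique h h'
    ecol-proper (copy-copy {h = h} {h'} _) copy-base _ = apex≢clique h h' ∘ sym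
    ecol-proper (copy-copy {v} {h} {h'} _) (copy-copy {h' = h''} _) h'≢h'' =
      h'≢h'' ∘ cong (copy v) ∘ toℕ-injective
      ∘ +-%-injectiveʳ (suc (toℕ h)) (m<n⇒m<1+n (toℕ<n h')) (m<n⇒m<1+n (toℕ<n h''))

    ecol≢vcolˡ : ∀ {u v} → CoronaEdge u v → ec u v ≢ vc u
    ecol≢vcolˡ (base-base ab)       = f-edge≢vertexˡ ab ∘ shift-injective
    ecol≢vcolˡ (base-copy {h = h})  = below≢shifted _ (toℕ<n h)
    ecol≢vcolˡ (copy-base {h = h})  = below≢shifted _ (toℕ<n h)
    ecol≢vcolˡ (copy-copy {v} {h} {h'} _) = atMost≢shifted (copy-edge≤m {v} {h} (copy v h')) (copyColour-pos v h)

    ecol≢vcolʳ : ∀ {u v} → CoronaEdge u v → ec u v ≢ vc v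
    ecol≢vcolʳ (base-base ab)       = f-edge≢vertexʳ ab ∘ shift-injective
    ecol≢vcolʳ (base-copy {h = h})  = below≢shifted _ (toℕ<n h)
    ecol≢vcolʳ (copy-base {h = h})  = below≢shifted _ (toℕ<n h)
    ecol≢vcolʳ (copy-copy {v} {h} {h'} _) = atMost≢shifted (copy-edge≤m {v} {h} (copy v h')) (copyColour-pos v h')

    distinguishes : ∀ {u v} → CoronaEdge u v → ¬ SameColours u v
    distinguishes (base-base ab) same = proj₂ f-avd _ _ ab λ c →
        unshift∈ ∘ proj₁ (same _) ∘ shift∈
      , unshift∈ ∘ proj₂ (same _) ∘ shift∈
    distinguishes base-copy = base-copy-distinct
    distinguishes copy-base = base-copy-distinct ∘ (λ same c → swap (same c))
    distinguishes (copy-copy {v} {h} {h'} hh') = separatedBy (inj₁ refl)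
      (avoid-injective _ (side-proper h h' hh') ∘ copy∋shifted (copyColour-pos v h))

  m<K : ∀ {K} → m + 4 ≤ K → m < K
  m<K = <-≤-trans (m<m+n m (s≤s z≤n))

  vc< : ∀ {K} → m + k ≤ K → m + 4 ≤ K → ∀ u → vc u < K
  vc< m+k≤K _     (base a)   = <-≤-trans (+-monoʳ-< m (toℕ<n (fv a))) m+k≤K
  vc< _     m+4≤K (copy v h) = <-≤-trans (+-monoʳ-< m (s≤s (avoid-≤3 (side h) _))) m+4≤K

  ec< : ∀ {K} → m + k ≤ K → m + 4 ≤ K → ∀ u w → ec u w < K
  ec< m+k≤K _ (base a) (base b) = <-≤-trans (+-monoʳ-< m (toℕ<n (fe a b))) m+k≤K
  ec< _ m+4≤K (base _) (copy _ h) = <-trans (toℕ<n h) (m<K m+4≤K)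
  ec< _ m+4≤K (copy v h) w        = ≤-<-trans (copy-edge≤m w) (m<K m+4≤K)

first-step : ∀ {n} {G : Graph n} {u w} → Reach G u w → u ≢ w → ∃[ x ] Adj G u x
first-step here             u≢u = ⊥-elim (u≢u refl)
first-step (step {w = x} ux _) _ = x , ux

has-neighbour : ∀ {n} {G : Graph n} → Connected G → 2 ≤ n → ∀ v → ∃[ u ] Adj G v u
has-neighbour connected (s≤s (s≤s _)) v =
  first-step (connected v (punchIn v zero)) (punchInᵢ≢i v zero ∘ sym)

theorem6 : ∀ {n m} (G : Graph n) (H : Graph m) →
    IsSimple G → Connected G → 2 ≤ n → χ''ₐ≤ G (Δ G + 3) →
    IsSimple H → IsBipartite H → Δ H ≡ Δ G + 3 →
    χ''ₐ≤ (corona G H) (Δ (corona G H) + 3)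
theorem6 {m = m} G H _ connected 2≤n@(s≤s _) (k , k≤ΔG+3 , f , f-avd) _ (side , side-proper) _ =
  Δ (corona G H) + 3 , ≤-refl ,
  avdColourable vc ec (vc< m+k≤K m+4≤K) (ec< m+k≤K m+4≤K) avd
  where
  neighbour : ∀ v → ∃[ u ] Adj G v u
  neighbour = has-neighbour connected 2≤n
  open Corona G H
  open Construction f f-avd side side-proper neighbour

  ΔG+m≤Δ : Δ G + m ≤ Δ (corona G H)
  ΔG+m≤Δ = Δ+≤ G zero λ v → ≤-trans (degree-base v) (degree≤Δ (corona G H) (encode (base v)))

  m+[ΔG+3]≤K : m + (Δ G + 3) ≤ Δ (corona G H) + 3
  m+[ΔG+3]≤K = subst (_≤ Δ (corona G H) + 3) (trans (cong (_+ 3) (+-comm (Δ G) m)) (+-assoc m (Δ G) 3))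
                     (+-monoˡ-≤ 3 ΔG+m≤Δ)

  m+k≤K : m + k ≤ Δ (corona G H) + 3
  m+k≤K = ≤-trans (+-monoʳ-≤ m k≤ΔG+3) m+[ΔG+3]≤K

  m+4≤K : m + 4 ≤ Δ (corona G H) + 3
  m+4≤K = ≤-trans (+-monoʳ-≤ m (+-monoˡ-≤ 3 1≤ΔG)) m+[ΔG+3]≤K
    where
    1≤ΔG : 1 ≤ Δ G
    1≤ΔG = ≤-trans (adj⇒1≤degree G (proj₂ (neighbour zero))) (degree≤Δ G zero)
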